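{- Let $b_{n,k}$ be the number of type $B$ merging-free set partitions of $\langle n\rangle$ without zero block having $k$ blocks. Then for $n\ge2$, \[ b_{n,k}=2k\,b_{n-1,k}+2(n-2)\,b_{n-2,k-1}, \] with $b_{0,0}=1$, $b_{1,0}=0$, $b_{1,1}=1$ (and $b_{m,j}=0$ for $j<0$).
   Context: $\langle n\rangle=\{0,\pm1,\dots,\pm n\}$, $[n]=\{1,\dots,n\}$. A type $B$ set partition of $\langle n\rangle$ without zero block is encoded as $\pi=\pi_1\mid\cdots\mid\pi_k$: nonempty sets of nonzero integers with the sets $\{|a|:a\in\pi_i\}$ partitioning $[n]$, the element of smallest absolute value $m_i$ of $\pi_i$ positive, $m_1<\cdots<m_k$; $k$ is the number of blocks (for $n=0$ only the empty partition, with $0$ blocks). It is merging-free if there is no $i\in\{2,\dots,k\}$ with $\max_{a\in\pi_{i-1}}|a|<m_i$. -}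

module Defs where

open import Data.Bool using (Bool; true; false; _∧_; not)
open import Data.Nat using (ℕ; zero; suc; _≡ᵇ_; _<ᵇ_)
open import Data.Integer using (ℤ; +_; -_; ∣_∣; +[1+_]; -[1+_])
open import Data.List using (List; []; _∷_; map; concatMap; filter; length; upTo; _++_)
open import Data.Bool.ListAction using (all; any)
open import Relation.Nullary.Decidable using (Dec; yes; no)
open import Data.Bool using (T?)

-- A type B set partition of ⟨n⟩ without zero block, π = π₁ ∣ ⋯ ∣ π_k, is encoded
-- as the list of its blocks in order π₁, …, π_k; each block (a finite set of nonzero
-- integers) is encoded canonically as the list of its elements sorted by strictly
-- increasing absolute value (absolute values within a block are distinct since the
-- sets {|a| : a ∈ πᵢ} partition [n]).
Block : Set
Block = List ℤ

Partition : Set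
Partition = List Block

range1 : ℕ → List ℕ
range1 n = map suc (upTo n)

signedVals : ℕ → List ℤ
signedVals n = map (λ i → + i) (range1 n) ++ map (λ i → - (+ i)) (range1 n)

words : ℕ → List ℤ → List (List ℤ)
words zero    vs = [] ∷ []
words (suc m) vs = concatMap (λ v → map (v ∷_) (words m vs)) vs

splits : {A : Set} → List A → List (List (List A))
splits []       = [] ∷ []
splits {A} (x ∷ xs) = concatMap ext (splits xs)
  where
  ext : List (List A) → List (List (List A))
  ext []         = ((x ∷ []) ∷ []) ∷ []
  ext (b ∷ rest) = ((x ∷ []) ∷ b ∷ rest) ∷ ((x ∷ b) ∷ rest) ∷ []

-- a finite list of candidate encodings, containing every encoding (each exactly once)
candidates : ℕ → List Partition
candidates n = concatMap splits (words n (signedVals n))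

memᵇ : ℕ → List ℕ → Bool
memᵇ a = any (a ≡ᵇ_)

noDupᵇ : List ℕ → Bool
noDupᵇ []       = true
noDupᵇ (x ∷ xs) = not (memᵇ x xs) ∧ noDupᵇ xs

increasingᵇ : List ℕ → Bool
increasingᵇ []            = true
increasingᵇ (x ∷ [])      = true
increasingᵇ (x ∷ y ∷ xs)  = (x <ᵇ y) ∧ increasingᵇ (y ∷ xs)

absVals : Partition → List ℕ
absVals π = concatMap (map ∣_∣) π

isPositive : ℤ → Bool
isPositive +[1+ _ ] = true
isPositive _        = false

validBlockᵇ : Block → Bool
validBlockᵇ []      = false
validBlockᵇ (a ∷ b) = isPositive a ∧ increasingᵇ (map ∣_∣ (a ∷ b))

mins : Partition → List ℕ
mins []             = []
mins ([] ∷ π)       = mins π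
mins ((a ∷ _) ∷ π)  = ∣ a ∣ ∷ mins π

-- π is a (canonically encoded) type B set partition of ⟨n⟩ without zero block:
-- blocks valid, the sets {|a| : a ∈ πᵢ} partition [n] (every absolute value lies in
-- [n], no value repeated, and exactly n values occur), and m₁ < ⋯ < m_k.
isTypeBPartitionᵇ : ℕ → Partition → Bool
isTypeBPartitionᵇ n π =
  all validBlockᵇ π
  ∧ all (λ a → memᵇ a (range1 n)) (absVals π)
  ∧ noDupᵇ (absVals π)
  ∧ (length (absVals π) ≡ᵇ n)
  ∧ increasingᵇ (mins π)

maxAbs : Block → ℕ
maxAbs []      = 0
maxAbs (a ∷ b) = Data.Nat._⊔_ ∣ a ∣ (maxAbs b)

minAbs : Block → ℕ
minAbs []      = 0
minAbs (a ∷ b) = ∣ a ∣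

mergingFreeᵇ : Partition → Bool
mergingFreeᵇ []            = true
mergingFreeᵇ (B ∷ [])      = true
mergingFreeᵇ (B ∷ C ∷ π)   = not (maxAbs B <ᵇ minAbs C) ∧ mergingFreeᵇ (C ∷ π)

b : ℕ → ℕ → ℕ
b n k = length (filter (λ π → T? (isTypeBPartitionᵇ n π ∧ mergingFreeᵇ π ∧ (length π ≡ᵇ k)))
                       (candidates n))

-- Every type B partition of ⟨n+1⟩ arises from exactly one of ⟨n⟩, by appending n+1 or -(n+1)
-- to one of its blocks or by adding the block {n+1} at the end; deleting ±(n+1) undoes this.
-- Call i a merging position of π when max|πᵢ| < mᵢ₊₁. Appending to block i destroys the merging
-- position after block i, if there is one, and keeps the others; the new last block creates one.
-- Hence the number b′ n k v of partitions of ⟨n⟩ with k blocks and v merging positions satisfies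
--   b′(n+2,k,v) = 2(v+1) b′(n+1,k,v+1) + 2(k-v) b′(n+1,k,v) + b′(n+1,k-1,v-1),
-- and induction on m using only this recurrence gives (v+1) b′(m+1,k+1,v+1) = m b′(m,k,v).
-- Since b n k = b′ n k 0, the recurrence for v = 0 together with this identity for v = 0 is the
-- theorem. That b n k = b′ n k 0 holds because the candidate list filtered in the definition of b
-- and the generated list both have no repetitions and contain the same partitions.

module Submission where

open import Defs
open import Data.Bool using (Bool; true; false; T; T?; not; _∧_)
open import Data.Bool.Properties using (T-∧; T-≡; T-not-≡; ∧-comm; ∧-zeroʳ)
open import Data.Empty using (⊥; ⊥-elim)
open import Data.Integer using (ℤ; +_; -_; ∣_∣; +[1+_]; -[1+_])
open import Data.Integer.Properties using (+-injective; neg-injective; ∣-i∣≡∣i∣)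
open import Data.List using (List; []; _∷_; _++_; _∷ʳ_; [_]; map; concat; concatMap; filter; length; upTo)
open import Data.List.Properties
  using (∷-injectiveˡ; ∷-injectiveʳ; ∷ʳ-injectiveʳ; length-++; length-++-sucʳ; length-map; length-upTo;
         map-++; map-∘; map-cong-local; ++-assoc; ++-identityʳ; concat-map; concatMap-cong; concatMap-++;
         filter-all; filter-accept; filter-reject; filter-++)
open import Data.List.Membership.Propositional using (_∈_; find; lose)
open import Data.List.Membership.Propositional.Properties
  using (∈-map⁺; ∈-map⁻; ∈-++⁺ˡ; ∈-++⁺ʳ; ∈-++⁻; ∈-∃++; ∈-concatMap⁺; ∈-concatMap⁻;
         ∈-filter⁺; ∈-filter⁻; ∈-upTo⁺; ∈-upTo⁻)
open import Data.List.Relation.Binary.Disjoint.Propositional using (Disjoint)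
open import Data.List.Relation.Binary.Permutation.Propositional
  using (_↭_; ↭-reflexive; ↭-sym; ↭-trans; ↭⇒↭ₛ)
open import Data.List.Relation.Binary.Permutation.Propositional.Properties
  using (↭-length; All-resp-↭; ∈-resp-↭; ++⁺ˡ; ++-comm; shift)
import Data.List.Relation.Binary.Permutation.Setoid.Properties as ↭ₛ
open import Data.List.Relation.Binary.Subset.Propositional using (_⊆_)
open import Data.List.Relation.Unary.All as All using (All; []; _∷_)
open import Data.List.Relation.Unary.All.Properties
  using (++⁻ˡ; ++⁻ʳ; ∷ʳ⁺; map⁻; all⁺; all⁻; ¬Any⇒All¬; All¬⇒¬Any)
open import Data.List.Relation.Unary.AllPairs as AllPairs using ([]; _∷_)
open import Data.List.Relation.Unary.Any as Any using (Any; here; there)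
open import Data.List.Relation.Unary.Any.Properties using (any⁺; any⁻)
open import Data.List.Relation.Unary.Linked as Linked using (Linked; []; [-]; _∷_)
import Data.List.Relation.Unary.Linked.Properties as Linked
open import Data.List.Relation.Unary.Unique.Propositional using (Unique)
import Data.List.Relation.Unary.Unique.Propositional.Properties as Unique
open import Data.Nat using (ℕ; zero; suc; _+_; _*_; _∸_; _≤_; _<_; z≤n; s≤s; _≡ᵇ_; _<ᵇ_; _≟_)
open import Data.Nat.Properties
  using (≤-refl; ≤-reflexive; ≤-trans; ≤-antisym; <-trans; ≤-pred; <⇒≤; <⇒≱; ≤∧≢⇒<; m≤n⇒m≤1+n;
         1+n≰n; 1+n≢n; suc-injective; +-comm; +-assoc; +-suc; +-identityʳ; *-zeroʳ; +-∸-assoc;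
         ⊔-lub; m≤m⊔n; m≤n⇒m≤o⊔n; ≡ᵇ⇒≡; ≡⇒≡ᵇ; <ᵇ⇒<; <⇒<ᵇ; module ≤-Reasoning)
open import Data.List.Membership.DecPropositional _≟_ using (_∈?_)
open import Data.Nat.Tactic.RingSolver using (solve-∀)
open import Data.Product using (_×_; _,_; proj₁; proj₂; map₂; ∃-syntax)
open import Data.Sum using (_⊎_; inj₁; inj₂)
open import Function using (id; _∘_; _⇔_; mk⇔; Equivalence)
open import Relation.Binary.PropositionalEquality hiding ([_])
open import Relation.Nullary using (¬_; Dec; yes; no; ¬?)

module _ {A : Set} where

  Unique-resp-↭ : {xs ys : List A} → xs ↭ ys → Unique xs → Unique ys
  Unique-resp-↭ p = ↭ₛ.Unique-resp-↭ (setoid A) (↭⇒↭ₛ p)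

  Unique-⊆⇒length≤ : {xs ys : List A} → Unique xs → xs ⊆ ys → length xs ≤ length ys
  Unique-⊆⇒length≤ {[]} _ _ = z≤n
  Unique-⊆⇒length≤ {x ∷ xs} {ys} (x∉xs ∷ u) xs⊆ys with ys₁ , ys₂ , refl ← ∈-∃++ (xs⊆ys (here refl)) =
    ≤-trans (s≤s (Unique-⊆⇒length≤ u xs⊆ys₁++ys₂)) (≤-reflexive (sym (length-++-sucʳ ys₁ x ys₂)))
    where
    xs⊆ys₁++ys₂ : xs ⊆ ys₁ ++ ys₂
    xs⊆ys₁++ys₂ z∈xs with ∈-resp-↭ (shift x ys₁ ys₂) (xs⊆ys (there z∈xs))
    ... | here refl = ⊥-elim (All.lookup x∉xs z∈xs refl)
    ... | there z∈  = z∈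

  Unique-⊆-⊇⇒length≡ : {xs ys : List A} → Unique xs → Unique ys → xs ⊆ ys → ys ⊆ xs →
    length xs ≡ length ys
  Unique-⊆-⊇⇒length≡ u v xs⊆ys ys⊆xs =
    ≤-antisym (Unique-⊆⇒length≤ u xs⊆ys) (Unique-⊆⇒length≤ v ys⊆xs)

  Unique-concatMap⁺ : {B : Set} {f : A → List B} {xs : List A} → Unique xs →
    (∀ {x} → x ∈ xs → Unique (f x)) →
    (∀ {x x′ y} → x ∈ xs → x′ ∈ xs → y ∈ f x → y ∈ f x′ → x ≡ x′) →
    Unique (concatMap f xs)
  Unique-concatMap⁺ {xs = []} _ _ _ = []
  Unique-concatMap⁺ {f = f} {xs = x ∷ xs} (x∉xs ∷ u) unique-f fibres =
    Unique.++⁺ (unique-f (here refl))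
               (Unique-concatMap⁺ u (unique-f ∘ there) (λ p q → fibres (there p) (there q)))
               disjoint
    where
    disjoint : Disjoint (f x) (concatMap f xs)
    disjoint (y∈fx , y∈rest) with x′ , x′∈xs , y∈fx′ ← find (∈-concatMap⁻ f y∈rest) =
      All.lookup x∉xs x′∈xs (fibres (here refl) (there x′∈xs) y∈fx y∈fx′)

  Unique-++⁻ʳ : (xs : List A) {ys : List A} → Unique (xs ++ ys) → Unique ys
  Unique-++⁻ʳ []       u       = u
  Unique-++⁻ʳ (x ∷ xs) (_ ∷ u) = Unique-++⁻ʳ xs u

  Unique-++⁻-disjoint : (xs : List A) {ys : List A} → Unique (xs ++ ys) → Disjoint xs ys
  Unique-++⁻-disjoint (x ∷ xs) (x∉ ∷ _) (here refl , x∈ys) = All.lookup x∉ (∈-++⁺ʳ xs x∈ys) refl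
  Unique-++⁻-disjoint (x ∷ xs) (_ ∷ u)  (there y∈xs , y∈ys) = Unique-++⁻-disjoint xs u (y∈xs , y∈ys)

  Linked-∷ʳ : {R : A → A → Set} {xs : List A} {y : A} → Linked R xs → All (λ x → R x y) xs →
    Linked R (xs ∷ʳ y)
  Linked-∷ʳ []      []       = [-]
  Linked-∷ʳ [-]     (r ∷ []) = r ∷ [-]
  Linked-∷ʳ (r ∷ l) (_ ∷ rs) = r ∷ Linked-∷ʳ l rs

  Linked-∷ʳ⁻ : {R : A → A → Set} (xs : List A) {y : A} → Linked R (xs ∷ʳ y) → Linked R xs
  Linked-∷ʳ⁻ []           _       = []
  Linked-∷ʳ⁻ (x ∷ [])     _       = [-]
  Linked-∷ʳ⁻ (x ∷ z ∷ xs) (r ∷ l) = r ∷ Linked-∷ʳ⁻ (z ∷ xs) l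

  length-∷ʳ : (xs : List A) {y : A} → length (xs ∷ʳ y) ≡ suc (length xs)
  length-∷ʳ xs = trans (length-++ xs) (+-comm (length xs) 1)

  ∷ʳ-≢ : (xs : List A) {y : A} → xs ∷ʳ y ≢ xs
  ∷ʳ-≢ xs e = 1+n≢n (trans (sym (length-∷ʳ xs)) (cong length e))

⟦_⟧ : Bool → ℕ
⟦ true ⟧  = 1
⟦ false ⟧ = 0

count : {A : Set} → (A → Bool) → List A → ℕ
count p []       = 0
count p (x ∷ xs) = ⟦ p x ⟧ + count p xs

module _ {A : Set} where

  count-++ : ∀ (p : A → Bool) xs ys → count p (xs ++ ys) ≡ count p xs + count p ys
  count-++ p []       ys = refl
  count-++ p (x ∷ xs) ys = trans (cong (_+_ ⟦ p x ⟧) (count-++ p xs ys)) (sym (+-assoc ⟦ p x ⟧ _ _))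

  count-map : {B : Set} (p : A → Bool) (f : B → A) (xs : List B) → count p (map f xs) ≡ count (p ∘ f) xs
  count-map p f []       = refl
  count-map p f (x ∷ xs) = cong (_+_ ⟦ p (f x) ⟧) (count-map p f xs)

  count-cong-local : {p q : A → Bool} {xs : List A} → All (λ x → p x ≡ q x) xs → count p xs ≡ count q xs
  count-cong-local []       = refl
  count-cong-local (e ∷ es) = cong₂ _+_ (cong ⟦_⟧ e) (count-cong-local es)

  count-none : {p : A → Bool} {xs : List A} → All (λ x → p x ≡ false) xs → count p xs ≡ 0
  count-none []       = refl
  count-none (e ∷ es) rewrite e = count-none es

  count≡length-filter : ∀ (p : A → Bool) xs → count p xs ≡ length (filter (λ x → T? (p x)) xs)
  count≡length-filter p []       = refl
  count≡length-filter p (x ∷ xs) with p x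
  ... | true  = cong suc (count≡length-filter p xs)
  ... | false = count≡length-filter p xs

T-not : ∀ {b} → T (not b) ⇔ (¬ T b)
T-not {true}  = mk⇔ (λ ()) (λ ¬t → ¬t _)
T-not {false} = mk⇔ (λ _ ()) _

T-memᵇ : ∀ {a xs} → T (memᵇ a xs) ⇔ a ∈ xs
T-memᵇ {a} {xs} = mk⇔ (Any.map (≡ᵇ⇒≡ a _) ∘ any⁻ _ xs) (any⁺ _ ∘ Any.map (≡⇒≡ᵇ a _))

T-noDup : ∀ {xs} → T (noDupᵇ xs) ⇔ Unique xs
T-noDup = mk⇔ to from
  where
  to : ∀ {xs} → T (noDupᵇ xs) → Unique xs
  to {[]}     _ = []
  to {x ∷ xs} t = let t₁ , t₂ = Equivalence.to T-∧ t in
    ¬Any⇒All¬ xs (Equivalence.to T-not t₁ ∘ Equivalence.from T-memᵇ) ∷ to t₂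
  from : ∀ {xs} → Unique xs → T (noDupᵇ xs)
  from []         = _
  from (x∉xs ∷ u) =
    Equivalence.from T-∧ (Equivalence.from T-not (All¬⇒¬Any x∉xs ∘ Equivalence.to T-memᵇ) , from u)

T-increasing : ∀ {xs} → T (increasingᵇ xs) ⇔ Linked _<_ xs
T-increasing = mk⇔ to from
  where
  to : ∀ {xs} → T (increasingᵇ xs) → Linked _<_ xs
  to {[]}         _ = []
  to {x ∷ []}     _ = [-]
  to {x ∷ y ∷ xs} t = let t₁ , t₂ = Equivalence.to T-∧ t in <ᵇ⇒< x y t₁ ∷ to t₂
  from : ∀ {xs} → Linked _<_ xs → T (increasingᵇ xs)
  from []      = _
  from [-]     = _
  from (r ∷ l) = Equivalence.from T-∧ (<⇒<ᵇ r , from l)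

∈-range1 : ∀ {a n} → a ∈ range1 n ⇔ (0 < a × a ≤ n)
∈-range1 = mk⇔ to from
  where
  to : ∀ {a n} → a ∈ range1 n → 0 < a × a ≤ n
  to a∈ with i , i∈ , refl ← ∈-map⁻ suc a∈ = s≤s z≤n , ∈-upTo⁻ i∈
  from : ∀ {a n} → 0 < a × a ≤ n → a ∈ range1 n
  from {suc i} (_ , le) = ∈-map⁺ suc (∈-upTo⁺ le)

data ValidBlock : Block → Set where
  valid : ∀ {a B} → T (isPositive a) → Linked _<_ (map ∣_∣ (a ∷ B)) → ValidBlock (a ∷ B)

T-validBlock : ∀ {B} → T (validBlockᵇ B) ⇔ ValidBlock B
T-validBlock {[]}    = mk⇔ (λ ()) (λ ())
T-validBlock {a ∷ B} = mk⇔ to from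
  where
  to : T (validBlockᵇ (a ∷ B)) → ValidBlock (a ∷ B)
  to t = let t₁ , t₂ = Equivalence.to T-∧ t in valid t₁ (Equivalence.to T-increasing t₂)
  from : ValidBlock (a ∷ B) → T (validBlockᵇ (a ∷ B))
  from (valid pos inc) = Equivalence.from T-∧ (pos , Equivalence.from T-increasing inc)

increasing : ∀ {B} → ValidBlock B → Linked _<_ (map ∣_∣ B)
increasing (valid _ inc) = inc

record IsTypeB (n : ℕ) (π : Partition) : Set where
  field
    blocks  : All ValidBlock π
    bounded : All (λ a → 0 < a × a ≤ n) (absVals π)
    unique  : Unique (absVals π)
    size    : length (absVals π) ≡ n
    sorted  : Linked _<_ (mins π)

T-isTypeBPartition : ∀ {n π} → T (isTypeBPartitionᵇ n π) ⇔ IsTypeB n π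
T-isTypeBPartition {n} {π} = mk⇔ to from
  where
  to : T (isTypeBPartitionᵇ n π) → IsTypeB n π
  to t =
    let t₁ , t′   = Equivalence.to T-∧ t
        t₂ , t″   = Equivalence.to T-∧ t′
        t₃ , t‴   = Equivalence.to T-∧ t″
        t₄ , t₅   = Equivalence.to T-∧ t‴
    in record
    { blocks  = All.map (Equivalence.to T-validBlock) (all⁺ validBlockᵇ π t₁)
    ; bounded = All.map (Equivalence.to ∈-range1 ∘ Equivalence.to T-memᵇ) (all⁺ _ (absVals π) t₂)
    ; unique  = Equivalence.to T-noDup t₃
    ; size    = ≡ᵇ⇒≡ _ n t₄
    ; sorted  = Equivalence.to T-increasing t₅ }
  from : IsTypeB n π → T (isTypeBPartitionᵇ n π)
  from t = Equivalence.from T-∧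
    ( all⁻ validBlockᵇ (All.map (Equivalence.from T-validBlock) blocks)
    , Equivalence.from T-∧
      ( all⁻ _ (All.map (Equivalence.from T-memᵇ ∘ Equivalence.from ∈-range1) bounded)
      , Equivalence.from T-∧
        ( Equivalence.from T-noDup unique
        , Equivalence.from T-∧ (≡⇒≡ᵇ _ n size , Equivalence.from T-increasing sorted))))
    where open IsTypeB t

IsTypeB-nonEmpty : ∀ {n σ} → IsTypeB (suc n) σ → σ ≢ []
IsTypeB-nonEmpty t refl with () ← IsTypeB.size t

-- Generating type B partitions by inserting ±n

appendToBlock : ℤ → Partition → List Partition
appendToBlock x []      = []
appendToBlock x (B ∷ π) = ((B ∷ʳ x) ∷ π) ∷ map (B ∷_) (appendToBlock x π)

addSingleton : ℕ → Partition → Partition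
addSingleton N π = π ∷ʳ [ + N ]

children : ℕ → Partition → List Partition
children N π = appendToBlock (+ N) π ++ appendToBlock (- (+ N)) π ++ [ addSingleton N π ]

typeBPartitions : ℕ → List Partition
typeBPartitions zero    = [ [] ]
typeBPartitions (suc n) = concatMap (children (suc n)) (typeBPartitions n)

data Appended (x : ℤ) : Partition → Partition → Set where
  atHead : ∀ {B π}   → Appended x (B ∷ π) ((B ∷ʳ x) ∷ π)
  inTail : ∀ {B π σ} → Appended x π σ → Appended x (B ∷ π) (B ∷ σ)

data Child (N : ℕ) (π : Partition) : Partition → Set where
  appended  : ∀ {x σ} → ∣ x ∣ ≡ N → Appended x π σ → Child N π σ
  singleton : Child N π (addSingleton N π)

Child-∷ : ∀ {N π σ} B → Child N π σ → Child N (B ∷ π) (B ∷ σ)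
Child-∷ B (appended e a) = appended e (inTail a)
Child-∷ B singleton      = singleton

∈-appendToBlock⁻ : ∀ {x} π {σ} → σ ∈ appendToBlock x π → Appended x π σ
∈-appendToBlock⁻ (B ∷ π) (here refl) = atHead
∈-appendToBlock⁻ (B ∷ π) (there σ∈) with _ , σ′∈ , refl ← ∈-map⁻ (B ∷_) σ∈ =
  inTail (∈-appendToBlock⁻ π σ′∈)

∈-appendToBlock⁺ : ∀ {x π σ} → Appended x π σ → σ ∈ appendToBlock x π
∈-appendToBlock⁺ atHead     = here refl
∈-appendToBlock⁺ (inTail a) = there (∈-map⁺ (_ ∷_) (∈-appendToBlock⁺ a))

∈-children⁻ : ∀ {N π σ} → σ ∈ children N π → Child N π σ
∈-children⁻ {N} {π} σ∈ with ∈-++⁻ (appendToBlock (+ N) π) σ∈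
... | inj₁ σ∈⁺ = appended refl (∈-appendToBlock⁻ π σ∈⁺)
... | inj₂ σ∈′ with ∈-++⁻ (appendToBlock (- (+ N)) π) σ∈′
...   | inj₁ σ∈⁻         = appended (∣-i∣≡∣i∣ (+ N)) (∈-appendToBlock⁻ π σ∈⁻)
...   | inj₂ (here refl) = singleton

∈-children⁺ : ∀ {n π σ} → Child (suc n) π σ → σ ∈ children (suc n) π
∈-children⁺ (appended {x = +[1+ n ]} refl a) = ∈-++⁺ˡ (∈-appendToBlock⁺ a)
∈-children⁺ {π = π} (appended {x = -[1+ n ]} refl a) =
  ∈-++⁺ʳ (appendToBlock +[1+ n ] π) (∈-++⁺ˡ (∈-appendToBlock⁺ a))
∈-children⁺ {n} {π} singleton =
  ∈-++⁺ʳ (appendToBlock +[1+ n ] π) (∈-++⁺ʳ (appendToBlock -[1+ n ] π) (here refl))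

absVals-++ : ∀ π ρ → absVals (π ++ ρ) ≡ absVals π ++ absVals ρ
absVals-++ = concatMap-++ (map ∣_∣)

mins-++ : ∀ π ρ → mins (π ++ ρ) ≡ mins π ++ mins ρ
mins-++ []            ρ = refl
mins-++ ([] ∷ π)      ρ = mins-++ π ρ
mins-++ ((a ∷ B) ∷ π) ρ = cong (∣ a ∣ ∷_) (mins-++ π ρ)

All-mins : ∀ {P : ℕ → Set} π → All P (absVals π) → All P (mins π)
All-mins []            _        = []
All-mins ([] ∷ π)      ps       = All-mins π ps
All-mins ((a ∷ B) ∷ π) (p ∷ ps) = p ∷ All-mins π (++⁻ʳ (map ∣_∣ B) ps)

absVals-Appended : ∀ {x π σ} → Appended x π σ → absVals σ ↭ ∣ x ∣ ∷ absVals π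
absVals-Appended {x} (atHead {B} {π}) =
  ↭-trans (↭-reflexive (trans (cong (_++ absVals π) (map-++ ∣_∣ B [ x ])) (++-assoc (map ∣_∣ B) _ _)))
          (shift ∣ x ∣ (map ∣_∣ B) (absVals π))
absVals-Appended {x} (inTail {B} {π} a) =
  ↭-trans (++⁺ˡ (map ∣_∣ B) (absVals-Appended a)) (shift ∣ x ∣ (map ∣_∣ B) (absVals π))

absVals-Child : ∀ {N π σ} → Child N π σ → absVals σ ↭ N ∷ absVals π
absVals-Child (appended e a)    = subst (λ v → _ ↭ v ∷ _) e (absVals-Appended a)
absVals-Child {N} {π} singleton = ↭-trans (↭-reflexive (absVals-++ π _)) (++-comm (absVals π) [ N ])

mins-Appended : ∀ {x π σ} → All ValidBlock π → Appended x π σ → mins σ ≡ mins π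
mins-Appended (valid _ _ ∷ _)  atHead     = refl
mins-Appended (valid _ _ ∷ vs) (inTail a) = cong (_ ∷_) (mins-Appended vs a)

validBlock-∷ʳ : ∀ {B x} → ValidBlock B → All (_< ∣ x ∣) (map ∣_∣ B) → ValidBlock (B ∷ʳ x)
validBlock-∷ʳ {a ∷ B} {x} (valid pos inc) lt =
  valid pos (subst (Linked _<_) (sym (map-++ ∣_∣ (a ∷ B) [ x ])) (Linked-∷ʳ inc lt))

blocks-Appended : ∀ {x π σ} → All ValidBlock π → All (_< ∣ x ∣) (absVals π) → Appended x π σ →
  All ValidBlock σ
blocks-Appended (v ∷ vs) lt (atHead {B})   = validBlock-∷ʳ v (++⁻ˡ (map ∣_∣ B) lt) ∷ vs
blocks-Appended (v ∷ vs) lt (inTail {B} a) = v ∷ blocks-Appended vs (++⁻ʳ (map ∣_∣ B) lt) a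

absVals≢suc : ∀ {n π} → IsTypeB n π → All (_≢ suc n) (absVals π)
absVals≢suc {n} t = All.map (λ (_ , le) e → 1+n≰n (subst (_≤ n) e le)) (IsTypeB.bounded t)

IsTypeB-Child : ∀ {n π σ} → IsTypeB n π → Child (suc n) π σ → IsTypeB (suc n) σ
IsTypeB-Child {n} {π} {σ} t c = record
  { blocks  = blocks-Child c
  ; bounded = All-resp-↭ (↭-sym p) ((s≤s z≤n , ≤-refl) ∷ All.map (map₂ m≤n⇒m≤1+n) bounded)
  ; unique  = Unique-resp-↭ (↭-sym p) (All.map ≢-sym (absVals≢suc t) ∷ unique)
  ; size    = trans (↭-length p) (cong suc size)
  ; sorted  = sorted-Child c }
  where
  open IsTypeB t
  p : absVals σ ↭ suc n ∷ absVals π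
  p = absVals-Child c
  below : All (_< suc n) (absVals π)
  below = All.map (s≤s ∘ proj₂) bounded
  blocks-Child : ∀ {σ} → Child (suc n) π σ → All ValidBlock σ
  blocks-Child (appended e a) = blocks-Appended blocks (subst (λ N → All (_< N) (absVals π)) (sym e) below) a
  blocks-Child singleton      = ∷ʳ⁺ blocks (valid _ [-])
  sorted-Child : ∀ {σ} → Child (suc n) π σ → Linked _<_ (mins σ)
  sorted-Child (appended _ a) = subst (Linked _<_) (sym (mins-Appended blocks a)) sorted
  sorted-Child singleton      = subst (Linked _<_) (sym (mins-++ π _)) (Linked-∷ʳ sorted (All-mins π below))

typeBPartitions-sound : ∀ n {σ} → σ ∈ typeBPartitions n → IsTypeB n σ
typeBPartitions-sound zero    (here refl) = record { blocks = [] ; bounded = [] ; unique = [] ; size = refl ; sorted = [] }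
typeBPartitions-sound (suc n) σ∈ with π , π∈ , σ∈children ← find (∈-concatMap⁻ (children (suc n)) σ∈) =
  IsTypeB-Child (typeBPartitions-sound n π∈) (∈-children⁻ σ∈children)

-- Deleting ±n

abs≢? : (N : ℕ) (a : ℤ) → Dec (∣ a ∣ ≢ N)
abs≢? N a = ¬? (∣ a ∣ ≟ N)

deleteAbs : ℕ → Block → Block
deleteAbs N = filter (abs≢? N)

consNonEmpty : Block → Partition → Partition
consNonEmpty []      π = π
consNonEmpty (a ∷ B) π = (a ∷ B) ∷ π

removeAbs : ℕ → Partition → Partition
removeAbs N []      = []
removeAbs N (B ∷ σ) = consNonEmpty (deleteAbs N B) (removeAbs N σ)

deleteAbs-id : ∀ {N} B → All (_≢ N) (map ∣_∣ B) → deleteAbs N B ≡ B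
deleteAbs-id {N} B B∌N = filter-all (abs≢? N) (map⁻ B∌N)

deleteAbs-[x] : ∀ {N} x → ∣ x ∣ ≡ N → deleteAbs N [ x ] ≡ []
deleteAbs-[x] {N} x e = filter-reject (abs≢? N) {x} {[]} (λ ne → ne e)

deleteAbs-∷ʳ : ∀ {N x} B → ∣ x ∣ ≡ N → All (_≢ N) (map ∣_∣ B) → deleteAbs N (B ∷ʳ x) ≡ B
deleteAbs-∷ʳ {N} {x} B e B∌N = begin
    deleteAbs N (B ++ [ x ])         ≡⟨ filter-++ (abs≢? N) B [ x ] ⟩
    deleteAbs N B ++ deleteAbs N [ x ] ≡⟨ cong₂ _++_ (deleteAbs-id B B∌N) (deleteAbs-[x] x e) ⟩
    B ++ []                          ≡⟨ ++-identityʳ B ⟩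
    B                                ∎
  where open ≡-Reasoning

removeAbs-id : ∀ {N} π → All ValidBlock π → All (_≢ N) (absVals π) → removeAbs N π ≡ π
removeAbs-id []      _                π∌N = refl
removeAbs-id (B ∷ π) (valid _ _ ∷ vs) π∌N =
  cong₂ consNonEmpty (deleteAbs-id B (++⁻ˡ (map ∣_∣ B) π∌N))
                     (removeAbs-id π vs (++⁻ʳ (map ∣_∣ B) π∌N))

removeAbs-Appended : ∀ {N x π σ} → All ValidBlock π → All (_≢ N) (absVals π) → ∣ x ∣ ≡ N →
  Appended x π σ → removeAbs N σ ≡ π
removeAbs-Appended (valid _ _ ∷ vs) π∌N e (atHead {B} {π}) =
  cong₂ consNonEmpty (deleteAbs-∷ʳ B e (++⁻ˡ (map ∣_∣ B) π∌N))
                     (removeAbs-id π vs (++⁻ʳ (map ∣_∣ B) π∌N))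
removeAbs-Appended (valid _ _ ∷ vs) π∌N e (inTail {B} a) =
  cong₂ consNonEmpty (deleteAbs-id B (++⁻ˡ (map ∣_∣ B) π∌N))
                     (removeAbs-Appended vs (++⁻ʳ (map ∣_∣ B) π∌N) e a)

removeAbs-addSingleton : ∀ {N} π → removeAbs N (addSingleton N π) ≡ removeAbs N π
removeAbs-addSingleton {N} [] = cong (λ D → consNonEmpty D []) (deleteAbs-[x] (+ N) refl)
removeAbs-addSingleton {N} (B ∷ π) = cong (consNonEmpty (deleteAbs N B)) (removeAbs-addSingleton π)

removeAbs-Child : ∀ {n π σ} → IsTypeB n π → Child (suc n) π σ → removeAbs (suc n) σ ≡ π
removeAbs-Child t (appended e a) = removeAbs-Appended (IsTypeB.blocks t) (absVals≢suc t) e a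
removeAbs-Child {π = π} t singleton =
  trans (removeAbs-addSingleton π) (removeAbs-id π (IsTypeB.blocks t) (absVals≢suc t))

singleton-if-head-max : ∀ {N a} B → ∣ a ∣ ≡ N → Linked _<_ (map ∣_∣ (a ∷ B)) → All (_≤ N) (map ∣_∣ B) →
  B ≡ []
singleton-if-head-max []      _ _       _         = refl
singleton-if-head-max (b ∷ _) e (r ∷ _) (b≤N ∷ _) = ⊥-elim (<⇒≱ r (subst (∣ b ∣ ≤_) (sym e) b≤N))

validBlock-deleteAbs : ∀ {N B} → ValidBlock B → All (_≤ N) (map ∣_∣ B) →
  deleteAbs N B ≡ [] ⊎ ValidBlock (deleteAbs N B)
validBlock-deleteAbs {N} (valid {a} {B} pos inc) (_ ∷ B≤N) = by-head (∣ a ∣ ≟ N)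
  where
  by-head : Dec (∣ a ∣ ≡ N) → deleteAbs N (a ∷ B) ≡ [] ⊎ ValidBlock (deleteAbs N (a ∷ B))
  by-head (yes e) with refl ← singleton-if-head-max {a = a} B e inc B≤N = inj₁ (deleteAbs-[x] a e)
  by-head (no ne) = inj₂ (subst ValidBlock (sym (filter-accept (abs≢? N) {a} {B} ne)) (valid pos increasing′))
    where
    increasing′ : Linked _<_ (map ∣_∣ (a ∷ deleteAbs N B))
    increasing′ = Linked.map⁺ (Linked.∷-filter⁺ (abs≢? N) <-trans (Linked.map⁻ {f = ∣_∣} {xs = a ∷ B} inc))

blocks-removeAbs : ∀ {N} σ → All ValidBlock σ → All (_≤ N) (absVals σ) → All ValidBlock (removeAbs N σ)
blocks-removeAbs []      _        _   = []
blocks-removeAbs (B ∷ σ) (v ∷ vs) σ≤N =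
  consNonEmpty-valid (validBlock-deleteAbs v (++⁻ˡ (map ∣_∣ B) σ≤N))
                     (blocks-removeAbs σ vs (++⁻ʳ (map ∣_∣ B) σ≤N))
  where
  consNonEmpty-valid : ∀ {D ρ} → D ≡ [] ⊎ ValidBlock D → All ValidBlock ρ → All ValidBlock (consNonEmpty D ρ)
  consNonEmpty-valid (inj₁ refl)          vs = vs
  consNonEmpty-valid (inj₂ v@(valid _ _)) vs = v ∷ vs

split-maxAbs : ∀ {N} B → Linked _<_ (map ∣_∣ B) → All (_≤ N) (map ∣_∣ B) → N ∈ map ∣_∣ B →
  ∃[ D ] ∃[ x ] ∣ x ∣ ≡ N × All (_≢ N) (map ∣_∣ D) × B ≡ D ∷ʳ x
split-maxAbs {N} (a ∷ B) inc (_ ∷ B≤N) N∈ = by-head (∣ a ∣ ≟ N)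
  where
  by-head : Dec (∣ a ∣ ≡ N) → ∃[ D ] ∃[ x ] ∣ x ∣ ≡ N × All (_≢ N) (map ∣_∣ D) × a ∷ B ≡ D ∷ʳ x
  by-head (yes e) with refl ← singleton-if-head-max {a = a} B e inc B≤N = [] , a , e , [] , refl
  by-head (no ne) with D , x , e , D∌N , refl ← split-maxAbs B (Linked.tail inc) B≤N (Any.tail (ne ∘ sym) N∈) =
    a ∷ D , x , e , ne ∷ D∌N , refl

Child-consNonEmpty-∷ʳ : ∀ {N x} D σ → ∣ x ∣ ≡ N → ValidBlock (D ∷ʳ x) → All ValidBlock σ →
  All (_≤ N) (absVals σ) → Linked _<_ (mins ((D ∷ʳ x) ∷ σ)) → Child N (consNonEmpty D σ) ((D ∷ʳ x) ∷ σ)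
Child-consNonEmpty-∷ʳ (c ∷ C) σ e _ _ _ _ = appended e atHead
-- A block {x} with ∣ x ∣ = N has x = + N as its positive minimum, and it is the last block
-- because the block minima increase and are bounded by N.
Child-consNonEmpty-∷ʳ {x = +[1+ m ]} [] [] refl _ _ _ _ = singleton
Child-consNonEmpty-∷ʳ {x = +[1+ m ]} [] (_ ∷ _) refl _ (valid _ _ ∷ _) (c≤N ∷ _) (r ∷ _) =
  ⊥-elim (<⇒≱ r c≤N)
Child-consNonEmpty-∷ʳ {x = + zero}    [] _ _ (valid () _) _ _ _
Child-consNonEmpty-∷ʳ {x = -[1+ _ ]}  [] _ _ (valid () _) _ _ _

Child-removeAbs : ∀ {N} σ → All ValidBlock σ → All (_≤ N) (absVals σ) → Unique (absVals σ) →
  Linked _<_ (mins σ) → N ∈ absVals σ → Child N (removeAbs N σ) σ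
Child-removeAbs {N} (B ∷ σ) (v ∷ vs) σ≤N u sorted N∈ with ∈-++⁻ (map ∣_∣ B) N∈
... | inj₁ N∈B with D , x , e , D∌N , refl ← split-maxAbs B (increasing v) (++⁻ˡ (map ∣_∣ B) σ≤N) N∈B =
  subst₂ (λ D′ ρ → Child N (consNonEmpty D′ ρ) ((D ∷ʳ x) ∷ σ))
    (sym (deleteAbs-∷ʳ D e D∌N)) (sym (removeAbs-id σ vs σ∌N))
    (Child-consNonEmpty-∷ʳ D σ e v vs (++⁻ʳ (map ∣_∣ (D ∷ʳ x)) σ≤N) sorted)
  where
  σ∌N : All (_≢ N) (absVals σ)
  σ∌N = All.tabulate λ a∈ a≡N → Unique-++⁻-disjoint (map ∣_∣ (D ∷ʳ x)) u (N∈B , subst (_∈ _) a≡N a∈)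
... | inj₂ N∈σ =
  subst (λ D → Child N (consNonEmpty D (removeAbs N σ)) (B ∷ σ)) (sym (deleteAbs-id B B∌N))
    (consNonEmpty-Child v (Child-removeAbs σ vs (++⁻ʳ (map ∣_∣ B) σ≤N) (Unique-++⁻ʳ (map ∣_∣ B) u)
                                             (sorted-tail v sorted) N∈σ))
  where
  B∌N : All (_≢ N) (map ∣_∣ B)
  B∌N = All.tabulate λ a∈ a≡N → Unique-++⁻-disjoint (map ∣_∣ B) u (subst (_∈ _) a≡N a∈ , N∈σ)
  consNonEmpty-Child : ∀ {π σ} → ValidBlock B → Child N π σ → Child N (consNonEmpty B π) (B ∷ σ)
  consNonEmpty-Child (valid _ _) = Child-∷ B
  sorted-tail : ValidBlock B → Linked _<_ (mins (B ∷ σ)) → Linked _<_ (mins σ)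
  sorted-tail (valid _ _) = Linked.tail

IsTypeB-parent : ∀ {n π σ} → Child (suc n) π σ → All ValidBlock π → IsTypeB (suc n) σ → IsTypeB n π
IsTypeB-parent {n} {π} {σ} c π-blocks t = record
  { blocks  = π-blocks
  ; bounded = All.tabulate bound
  ; unique  = AllPairs.tail N∷π-unique
  ; size    = suc-injective (trans (sym (↭-length p)) size)
  ; sorted  = sorted-parent c }
  where
  open IsTypeB t
  p : absVals σ ↭ suc n ∷ absVals π
  p = absVals-Child c
  N∷π-unique : Unique (suc n ∷ absVals π)
  N∷π-unique = Unique-resp-↭ p unique
  bound : ∀ {a} → a ∈ absVals π → 0 < a × a ≤ n
  bound a∈ with pos , a≤N ← All.lookup bounded (∈-resp-↭ (↭-sym p) (there a∈)) =
    pos , ≤-pred (≤∧≢⇒< a≤N (λ a≡N → All.lookup (AllPairs.head N∷π-unique) a∈ (sym a≡N)))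
  sorted-parent : Child (suc n) π σ → Linked _<_ (mins π)
  sorted-parent (appended _ a) = subst (Linked _<_) (mins-Appended π-blocks a) sorted
  sorted-parent singleton      = Linked-∷ʳ⁻ (mins π) (subst (Linked _<_) (mins-++ π _) sorted)

max∈absVals : ∀ {n σ} → IsTypeB (suc n) σ → suc n ∈ absVals σ
max∈absVals {n} {σ} t with suc n ∈? absVals σ
... | yes N∈ = N∈
... | no  N∉ = ⊥-elim (1+n≰n (begin
    suc n                  ≡⟨ sym size ⟩
    length (absVals σ)     ≤⟨ Unique-⊆⇒length≤ unique absVals⊆range1 ⟩
    length (range1 n)      ≡⟨ trans (length-map suc (upTo n)) (length-upTo n) ⟩
    n                      ∎))
  where
  open IsTypeB t
  open ≤-Reasoning
  absVals⊆range1 : absVals σ ⊆ range1 n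
  absVals⊆range1 a∈ with pos , a≤N ← All.lookup bounded a∈ =
    Equivalence.from ∈-range1 (pos , ≤-pred (≤∧≢⇒< a≤N (λ a≡N → N∉ (subst (_∈ _) a≡N a∈))))

IsTypeB⇒Child-removeAbs : ∀ {n σ} → IsTypeB (suc n) σ → Child (suc n) (removeAbs (suc n) σ) σ
IsTypeB⇒Child-removeAbs {σ = σ} t = Child-removeAbs σ blocks (All.map proj₂ bounded) unique sorted (max∈absVals t)
  where open IsTypeB t

IsTypeB-removeAbs : ∀ {n σ} → IsTypeB (suc n) σ → IsTypeB n (removeAbs (suc n) σ)
IsTypeB-removeAbs {σ = σ} t =
  IsTypeB-parent (IsTypeB⇒Child-removeAbs t) (blocks-removeAbs σ (IsTypeB.blocks t) (All.map proj₂ (IsTypeB.bounded t))) t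

typeBPartitions-complete : ∀ n {σ} → IsTypeB n σ → σ ∈ typeBPartitions n
typeBPartitions-complete zero {[]} _ = here refl
typeBPartitions-complete zero {B ∷ σ} record { blocks = valid _ _ ∷ _ ; size = () }
typeBPartitions-complete (suc n) t =
  ∈-concatMap⁺ (children (suc n))
    (lose (typeBPartitions-complete n (IsTypeB-removeAbs t)) (∈-children⁺ (IsTypeB⇒Child-removeAbs t)))

-- The generated list has no repetitions

length-Appended : ∀ {x π σ} → Appended x π σ → length σ ≡ length π
length-Appended atHead     = refl
length-Appended (inTail a) = cong suc (length-Appended a)

Appended-injective : ∀ {x y π σ τ} → Appended x π σ → Appended y π τ → σ ≡ τ → x ≡ y
Appended-injective (atHead {B}) atHead     e = ∷ʳ-injectiveʳ B B (∷-injectiveˡ e)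
Appended-injective (atHead {B}) (inTail _) e = ⊥-elim (∷ʳ-≢ B (∷-injectiveˡ e))
Appended-injective (inTail {B} _) atHead   e = ⊥-elim (∷ʳ-≢ B (sym (∷-injectiveˡ e)))
Appended-injective (inTail a)   (inTail b) e = Appended-injective a b (∷-injectiveʳ e)

addSingleton-not-Appended : ∀ {N x π} → ¬ Appended x π (addSingleton N π)
addSingleton-not-Appended {π = π} a = 1+n≢n (trans (sym (length-∷ʳ π)) (length-Appended a))

appendToBlock-unique : ∀ x π → Unique (appendToBlock x π)
appendToBlock-unique x []      = []
appendToBlock-unique x (B ∷ π) = All.tabulate head∉tail ∷ Unique.map⁺ ∷-injectiveʳ (appendToBlock-unique x π)
  where
  head∉tail : ∀ {σ} → σ ∈ map (B ∷_) (appendToBlock x π) → (B ∷ʳ x) ∷ π ≢ σ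
  head∉tail σ∈ e with _ , _ , refl ← ∈-map⁻ (B ∷_) σ∈ = ∷ʳ-≢ B (∷-injectiveˡ e)

children-unique : ∀ n π → Unique (children (suc n) π)
children-unique n π =
  Unique.++⁺ (appendToBlock-unique _ π)
    (Unique.++⁺ (appendToBlock-unique _ π) ([] ∷ []) (λ (σ∈ , σ∈′) → negative-vs-singleton σ∈ σ∈′))
    (λ (σ∈ , σ∈′) → positive-vs-rest σ∈ σ∈′)
  where
  negative-vs-singleton : ∀ {σ} → σ ∈ appendToBlock -[1+ n ] π → σ ∈ [ addSingleton (suc n) π ] → ⊥
  negative-vs-singleton σ∈ (here refl) = addSingleton-not-Appended (∈-appendToBlock⁻ π σ∈)
  positive-vs-rest : ∀ {σ} → σ ∈ appendToBlock +[1+ n ] π →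
    σ ∈ appendToBlock -[1+ n ] π ++ [ addSingleton (suc n) π ] → ⊥
  positive-vs-rest σ∈ σ∈′ with ∈-++⁻ (appendToBlock -[1+ n ] π) σ∈′
  ... | inj₁ σ∈⁻ with () ← Appended-injective (∈-appendToBlock⁻ π σ∈) (∈-appendToBlock⁻ π σ∈⁻) refl
  ... | inj₂ (here refl) = addSingleton-not-Appended (∈-appendToBlock⁻ π σ∈)

typeBPartitions-unique : ∀ n → Unique (typeBPartitions n)
typeBPartitions-unique zero    = [] ∷ []
typeBPartitions-unique (suc n) =
  Unique-concatMap⁺ (typeBPartitions-unique n) (λ {π} _ → children-unique n π) same-parent
  where
  same-parent : ∀ {π π′ σ} → π ∈ typeBPartitions n → π′ ∈ typeBPartitions n →
    σ ∈ children (suc n) π → σ ∈ children (suc n) π′ → π ≡ π′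
  same-parent π∈ π′∈ σ∈ σ∈′ =
    trans (sym (removeAbs-Child (typeBPartitions-sound n π∈) (∈-children⁻ σ∈)))
          (removeAbs-Child (typeBPartitions-sound n π′∈) (∈-children⁻ σ∈′))

-- Merging positions

mergesWithNext : Block → Partition → Bool
mergesWithNext B []      = false
mergesWithNext B (C ∷ _) = maxAbs B <ᵇ minAbs C

mergeFlags : Partition → List Bool
mergeFlags []      = []
mergeFlags (B ∷ π) = mergesWithNext B π ∷ mergeFlags π

trues : List Bool → ℕ
trues = count id

length-mergeFlags : ∀ π → length (mergeFlags π) ≡ length π
length-mergeFlags []      = refl
length-mergeFlags (B ∷ π) = cong suc (length-mergeFlags π)

mergingFreeᵇ≡ : ∀ π → mergingFreeᵇ π ≡ (trues (mergeFlags π) ≡ᵇ 0)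
mergingFreeᵇ≡ []          = refl
mergingFreeᵇ≡ (B ∷ [])    = refl
mergingFreeᵇ≡ (B ∷ C ∷ π) = step (maxAbs B <ᵇ minAbs C) (mergingFreeᵇ≡ (C ∷ π))
  where
  step : ∀ d {b m} → b ≡ (m ≡ᵇ 0) → not d ∧ b ≡ (⟦ d ⟧ + m ≡ᵇ 0)
  step true  _ = refl
  step false e = e

shapeᵇ : ℕ → ℕ → List Bool → Bool
shapeᵇ k v fs = (length fs ≡ᵇ k) ∧ (trues fs ≡ᵇ v)

shapeᵇ-mergingFree : ∀ k π → shapeᵇ k 0 (mergeFlags π) ≡ mergingFreeᵇ π ∧ (length π ≡ᵇ k)
shapeᵇ-mergingFree k π rewrite length-mergeFlags π | mergingFreeᵇ≡ π = ∧-comm (length π ≡ᵇ k) _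

b′ : ℕ → ℕ → ℕ → ℕ
b′ n k v = count (shapeᵇ k v ∘ mergeFlags) (typeBPartitions n)

module _ {A : Set} where

  -- the function `ext` local to the definition of `splits`
  extendSplit : A → List (List A) → List (List (List A))
  extendSplit x []       = ((x ∷ []) ∷ []) ∷ []
  extendSplit x (B ∷ bs) = ((x ∷ []) ∷ B ∷ bs) ∷ ((x ∷ B) ∷ bs) ∷ []

  splits-∷ : ∀ x xs → splits (x ∷ xs) ≡ concatMap (extendSplit x) (splits xs)
  splits-∷ x xs = concatMap-cong (λ { [] → refl ; (_ ∷ _) → refl }) (splits xs)

  splits-sound : ∀ w {s} → s ∈ splits w → All (_≢ []) s × concat s ≡ w
  splits-sound []       (here refl) = [] , refl
  splits-sound (x ∷ xs) s∈
    with s′ , s′∈ , t∈ ← find (∈-concatMap⁻ _ (subst (_ ∈_) (splits-∷ x xs) s∈)) =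
    extendSplit-sound s′ (splits-sound xs s′∈) t∈
    where
    extendSplit-sound : ∀ s′ {t} → All (_≢ []) s′ × concat s′ ≡ xs → t ∈ extendSplit x s′ →
      All (_≢ []) t × concat t ≡ x ∷ xs
    extendSplit-sound []      (_ , c)       (here refl)         = (λ ()) ∷ [] , cong (x ∷_) c
    extendSplit-sound (_ ∷ _) (ne , c)      (here refl)         = (λ ()) ∷ ne , cong (x ∷_) c
    extendSplit-sound (_ ∷ _) (_ ∷ ne , c)  (there (here refl)) = (λ ()) ∷ ne , cong (x ∷_) c

  mutual
    splits-complete : ∀ s → All (_≢ []) s → s ∈ splits (concat s)
    splits-complete []      []               = here refl
    splits-complete (B ∷ s) (B≢[] ∷ nonEmpty) = splits-complete-∷ B s B≢[] nonEmpty

    splits-complete-∷ : ∀ B s → B ≢ [] → All (_≢ []) s → (B ∷ s) ∈ splits (B ++ concat s)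
    splits-complete-∷ []          s B≢[] _        = ⊥-elim (B≢[] refl)
    splits-complete-∷ (x ∷ [])    s _    nonEmpty =
      subst (_ ∈_) (sym (splits-∷ x (concat s)))
        (∈-concatMap⁺ _ (lose (splits-complete s nonEmpty) (first-extension s)))
      where
      first-extension : ∀ s → ((x ∷ []) ∷ s) ∈ extendSplit x s
      first-extension []      = here refl
      first-extension (_ ∷ _) = here refl
    splits-complete-∷ (x ∷ y ∷ B) s _    nonEmpty =
      subst (_ ∈_) (sym (splits-∷ x (y ∷ B ++ concat s)))
        (∈-concatMap⁺ _ (lose (splits-complete-∷ (y ∷ B) s (λ ()) nonEmpty) (there (here refl))))

  dropFirst : List (List A) → List (List A)
  dropFirst []                  = []
  dropFirst ([] ∷ bs)           = bs
  dropFirst ((x ∷ []) ∷ bs)     = bs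
  dropFirst ((x ∷ y ∷ B) ∷ bs)  = (y ∷ B) ∷ bs

  splits-unique : ∀ w → Unique (splits w)
  splits-unique []       = [] ∷ []
  splits-unique (x ∷ xs) = subst Unique (sym (splits-∷ x xs))
    (Unique-concatMap⁺ (splits-unique xs) extendSplit-unique same-parent)
    where
    extendSplit-unique : ∀ {s} → s ∈ splits xs → Unique (extendSplit x s)
    extendSplit-unique {[]}    _ = [] ∷ []
    extendSplit-unique {_ ∷ s} _ = ((λ e → 1+n≢n (cong length (∷-injectiveʳ e))) ∷ []) ∷ [] ∷ []
    dropFirst-extendSplit : ∀ {s t} → s ∈ splits xs → t ∈ extendSplit x s → dropFirst t ≡ s
    dropFirst-extendSplit {[]}    _  (here refl)         = refl
    dropFirst-extendSplit {_ ∷ _} _  (here refl)         = refl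
    dropFirst-extendSplit {B ∷ _} s∈ (there (here refl)) with B≢[] ∷ _ , _ ← splits-sound xs s∈ = by-block B B≢[]
      where
      by-block : ∀ B {bs} → B ≢ [] → dropFirst ((x ∷ B) ∷ bs) ≡ B ∷ bs
      by-block []      B≢[] = ⊥-elim (B≢[] refl)
      by-block (_ ∷ _) _    = refl
    same-parent : ∀ {s s′ t} → s ∈ splits xs → s′ ∈ splits xs → t ∈ extendSplit x s → t ∈ extendSplit x s′ →
      s ≡ s′
    same-parent s∈ s′∈ t∈ t∈′ =
      trans (sym (dropFirst-extendSplit s∈ t∈)) (dropFirst-extendSplit s′∈ t∈′)

words-unique : ∀ {vs : List ℤ} m → Unique vs → Unique (words m vs)
words-unique zero    _ = [] ∷ []
words-unique {vs} (suc m) u = Unique-concatMap⁺ u (λ _ → Unique.map⁺ ∷-injectiveʳ (words-unique m u)) same-head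
  where
  same-head : ∀ {v v′ w} → v ∈ vs → v′ ∈ vs → w ∈ map (v ∷_) (words m vs) → w ∈ map (v′ ∷_) (words m vs) →
    v ≡ v′
  same-head _ _ w∈ w∈′ with _ , _ , refl ← ∈-map⁻ _ w∈ | _ , _ , e ← ∈-map⁻ _ w∈′ = ∷-injectiveˡ e

words-complete : ∀ {vs : List ℤ} w → All (_∈ vs) w → w ∈ words (length w) vs
words-complete []      []         = here refl
words-complete (a ∷ w) (a∈ ∷ w∈) = ∈-concatMap⁺ _ (lose a∈ (∈-map⁺ (a ∷_) (words-complete w w∈)))

range1-unique : ∀ n → Unique (range1 n)
range1-unique n = Unique.map⁺ suc-injective (Unique.upTo⁺ n)

signedVals-unique : ∀ n → Unique (signedVals n)
signedVals-unique n =
  Unique.++⁺ (Unique.map⁺ +-injective (range1-unique n)) (Unique.map⁺ (+-injective ∘ neg-injective) (range1-unique n))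
    signs-differ
  where
  signs-differ : Disjoint (map +_ (range1 n)) (map (λ i → - (+ i)) (range1 n))
  signs-differ (a∈⁺ , a∈⁻) with _ , _ , refl ← ∈-map⁻ _ a∈⁺ with _ , j∈ , e ← ∈-map⁻ _ a∈⁻ =
    positive≢negative (proj₁ (Equivalence.to ∈-range1 j∈)) e
    where
    positive≢negative : ∀ {i j} → 0 < j → + i ≢ - (+ j)
    positive≢negative {j = suc _} _ ()

∈-signedVals : ∀ {n a} → 0 < ∣ a ∣ × ∣ a ∣ ≤ n → a ∈ signedVals n
∈-signedVals {n} {a = +[1+ i ]} bounds = ∈-++⁺ˡ (∈-map⁺ +_ (Equivalence.from ∈-range1 bounds))
∈-signedVals {n} {a = -[1+ i ]} bounds =
  ∈-++⁺ʳ (map +_ (range1 n)) (∈-map⁺ (λ i → - (+ i)) (Equivalence.from ∈-range1 bounds))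

candidates-unique : ∀ n → Unique (candidates n)
candidates-unique n = Unique-concatMap⁺ (words-unique n (signedVals-unique n)) (λ {w} _ → splits-unique w) same-word
  where
  same-word : ∀ {w w′ s} → w ∈ words n (signedVals n) → w′ ∈ words n (signedVals n) →
    s ∈ splits w → s ∈ splits w′ → w ≡ w′
  same-word {w} {w′} _ _ s∈ s∈′ = trans (sym (proj₂ (splits-sound w s∈))) (proj₂ (splits-sound w′ s∈′))

candidates-complete : ∀ {n σ} → IsTypeB n σ → σ ∈ candidates n
candidates-complete {n} {σ} t =
  ∈-concatMap⁺ splits (lose concat∈words (splits-complete σ (All.map nonEmpty blocks)))
  where
  open IsTypeB t
  length-concat : length (concat σ) ≡ n
  length-concat = trans (sym (length-map ∣_∣ (concat σ))) (trans (cong length (sym (concat-map σ))) size)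
  letters : All (_∈ signedVals n) (concat σ)
  letters = All.map ∈-signedVals (map⁻ (subst (All _) (concat-map σ) bounded))
  concat∈words : concat σ ∈ words n (signedVals n)
  concat∈words = subst (λ m → concat σ ∈ words m (signedVals n)) length-concat (words-complete (concat σ) letters)
  nonEmpty : ∀ {B} → ValidBlock B → B ≢ []
  nonEmpty (valid _ _) ()

b≡b′ : ∀ n k → b n k ≡ b′ n k 0
b≡b′ n k =
  trans (Unique-⊆-⊇⇒length≡ (Unique.filter⁺ typeB? (candidates-unique n))
                            (Unique.filter⁺ shape? (typeBPartitions-unique n))
                            candidates⊆ ⊇candidates)
        (sym (count≡length-filter _ (typeBPartitions n)))
  where
  typeB? : (π : Partition) → Dec (T (isTypeBPartitionᵇ n π ∧ mergingFreeᵇ π ∧ (length π ≡ᵇ k)))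
  typeB? π = T? (isTypeBPartitionᵇ n π ∧ mergingFreeᵇ π ∧ (length π ≡ᵇ k))
  shape? : (π : Partition) → Dec (T (shapeᵇ k 0 (mergeFlags π)))
  shape? π = T? (shapeᵇ k 0 (mergeFlags π))
  candidates⊆ : filter typeB? (candidates n) ⊆ filter shape? (typeBPartitions n)
  candidates⊆ {π} π∈
    with _ , t ← ∈-filter⁻ typeB? {xs = candidates n} π∈
    with t₁ , t₂ ← Equivalence.to T-∧ t =
    ∈-filter⁺ shape? (typeBPartitions-complete n (Equivalence.to T-isTypeBPartition t₁))
                     (subst T (sym (shapeᵇ-mergingFree k π)) t₂)
  ⊇candidates : filter shape? (typeBPartitions n) ⊆ filter typeB? (candidates n)
  ⊇candidates {π} π∈ with π∈P , t ← ∈-filter⁻ shape? {xs = typeBPartitions n} π∈ =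
    ∈-filter⁺ typeB? (candidates-complete isTypeB)
      (Equivalence.from T-∧ (Equivalence.from T-isTypeBPartition isTypeB , subst T (shapeᵇ-mergingFree k π) t))
    where
    isTypeB : IsTypeB n π
    isTypeB = typeBPartitions-sound n π∈P

-- Counting children by blocks and merging positions

clearings : List Bool → List (List Bool)
clearings []       = []
clearings (f ∷ fs) = (false ∷ fs) ∷ map (f ∷_) (clearings fs)

trues≤length : ∀ fs → trues fs ≤ length fs
trues≤length []           = z≤n
trues≤length (true ∷ fs)  = s≤s (trues≤length fs)
trues≤length (false ∷ fs) = m≤n⇒m≤1+n (trues≤length fs)

shapeᵇ-∸ : ∀ k v fs → (suc k ∸ v) * ⟦ shapeᵇ k v fs ⟧ ≡ suc (k ∸ v) * ⟦ shapeᵇ k v fs ⟧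
shapeᵇ-∸ k v fs with shapeᵇ k v fs in eq
... | false = trans (*-zeroʳ (suc k ∸ v)) (sym (*-zeroʳ (suc (k ∸ v))))
... | true  = cong (_* 1) (+-∸-assoc 1 v≤k)
  where
  v≤k : v ≤ k
  v≤k with length≡k , trues≡v ← Equivalence.to T-∧ (subst T (sym eq) _) =
    subst₂ _≤_ (≡ᵇ⇒≡ _ v trues≡v) (≡ᵇ⇒≡ _ k length≡k) (trues≤length fs)

count-clearings : ∀ fs k v →
  count (shapeᵇ k v) (clearings fs) ≡ suc v * ⟦ shapeᵇ k (suc v) fs ⟧ + (k ∸ v) * ⟦ shapeᵇ k v fs ⟧
count-clearings []           zero    zero    = refl
count-clearings []           zero    (suc v) = sym (trans (+-identityʳ _) (*-zeroʳ (suc (suc v))))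
count-clearings []           (suc k) v       = sym (cong₂ _+_ (*-zeroʳ (suc v)) (*-zeroʳ (suc k ∸ v)))
count-clearings (f ∷ fs)     zero    v       = begin
    count (shapeᵇ 0 v) (map (f ∷_) (clearings fs)) ≡⟨ count-map (shapeᵇ 0 v) (f ∷_) (clearings fs) ⟩
    count (λ _ → false) (clearings fs)            ≡⟨ count-none {xs = clearings fs} (All.tabulate (λ _ → refl)) ⟩
    0                                             ≡⟨ sym (cong₂ _+_ (*-zeroʳ (suc v)) (*-zeroʳ (0 ∸ v))) ⟩
    suc v * 0 + (0 ∸ v) * 0                       ∎
  where open ≡-Reasoning
count-clearings (false ∷ fs) (suc k) v       = begin
    s₀ + count (shapeᵇ (suc k) v) (map (false ∷_) (clearings fs))
      ≡⟨ cong (_+_ s₀) (trans (count-map _ (false ∷_) (clearings fs)) (count-clearings fs k v)) ⟩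
    s₀ + (suc v * s₁ + (k ∸ v) * s₀)
      ≡⟨ rearrange (suc v) (k ∸ v) s₁ s₀ ⟩
    suc v * s₁ + suc (k ∸ v) * s₀
      ≡⟨ cong (_+_ (suc v * s₁)) (sym (shapeᵇ-∸ k v fs)) ⟩
    suc v * s₁ + (suc k ∸ v) * s₀
      ∎
  where
  open ≡-Reasoning
  s₁ s₀ : ℕ
  s₁ = ⟦ shapeᵇ k (suc v) fs ⟧
  s₀ = ⟦ shapeᵇ k v fs ⟧
  rearrange : ∀ c d x y → y + (c * x + d * y) ≡ c * x + suc d * y
  rearrange = solve-∀
count-clearings (true ∷ fs)  (suc k) zero    = begin
    s₀ + count (shapeᵇ (suc k) 0) (map (true ∷_) (clearings fs))
      ≡⟨ cong (_+_ s₀) (trans (count-map _ (true ∷_) (clearings fs)) (count-none {xs = clearings fs} none)) ⟩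
    s₀ + 0
      ≡⟨ rearrange s₀ (suc k) ⟩
    1 * s₀ + suc k * 0
      ≡⟨ cong (λ z → 1 * s₀ + suc k * ⟦ z ⟧) (sym (∧-zeroʳ (length fs ≡ᵇ k))) ⟩
    1 * s₀ + suc k * ⟦ (length fs ≡ᵇ k) ∧ false ⟧
      ∎
  where
  open ≡-Reasoning
  s₀ : ℕ
  s₀ = ⟦ shapeᵇ k 0 fs ⟧
  none : All (λ g → (length g ≡ᵇ k) ∧ false ≡ false) (clearings fs)
  none = All.tabulate (λ {g} _ → ∧-zeroʳ (length g ≡ᵇ k))
  rearrange : ∀ x c → x + 0 ≡ 1 * x + c * 0
  rearrange = solve-∀
count-clearings (true ∷ fs)  (suc k) (suc v) = begin
    s₁ + count (shapeᵇ (suc k) (suc v)) (map (true ∷_) (clearings fs))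
      ≡⟨ cong (_+_ s₁) (trans (count-map _ (true ∷_) (clearings fs)) (count-clearings fs k v)) ⟩
    s₁ + (suc v * s₁ + (k ∸ v) * s₀)
      ≡⟨ rearrange (suc v) (k ∸ v) s₁ s₀ ⟩
    suc (suc v) * s₁ + (k ∸ v) * s₀
      ∎
  where
  open ≡-Reasoning
  s₁ s₀ : ℕ
  s₁ = ⟦ shapeᵇ k (suc v) fs ⟧
  s₀ = ⟦ shapeᵇ k v fs ⟧
  rearrange : ∀ c d x y → x + (c * x + d * y) ≡ suc c * x + d * y
  rearrange = solve-∀

<ᵇ-false : ∀ {m n} → n ≤ m → (m <ᵇ n) ≡ false
<ᵇ-false {m} {n} n≤m = Equivalence.to T-not-≡ (Equivalence.from T-not (λ m<n → <⇒≱ (<ᵇ⇒< m n m<n) n≤m))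

∣x∣≤maxAbs-∷ʳ : ∀ B x → ∣ x ∣ ≤ maxAbs (B ∷ʳ x)
∣x∣≤maxAbs-∷ʳ []      x = m≤m⊔n ∣ x ∣ 0
∣x∣≤maxAbs-∷ʳ (b ∷ B) x = m≤n⇒m≤o⊔n ∣ b ∣ (∣x∣≤maxAbs-∷ʳ B x)

maxAbs< : ∀ {N} B → All (_< suc N) (map ∣_∣ B) → maxAbs B < suc N
maxAbs< []      []       = s≤s z≤n
maxAbs< (b ∷ B) (p ∷ ps) = ⊔-lub p (maxAbs< B ps)

mergesWithNext-∷ʳ : ∀ {x} B π → All (_< ∣ x ∣) (absVals π) → mergesWithNext (B ∷ʳ x) π ≡ false
mergesWithNext-∷ʳ     B []            _         = refl
mergesWithNext-∷ʳ     B ([] ∷ π)      _         = refl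
mergesWithNext-∷ʳ {x} B ((c ∷ C) ∷ π) (c<x ∷ _) = <ᵇ-false (≤-trans (<⇒≤ c<x) (∣x∣≤maxAbs-∷ʳ B x))

mergesWithNext-Appended : ∀ B {x π τ} → All ValidBlock π → Appended x π τ →
  mergesWithNext B τ ≡ mergesWithNext B π
mergesWithNext-Appended B (valid _ _ ∷ _) atHead     = refl
mergesWithNext-Appended B _               (inTail _) = refl

mergeFlags-appendToBlock : ∀ {x} π → All ValidBlock π → All (_< ∣ x ∣) (absVals π) →
  map mergeFlags (appendToBlock x π) ≡ clearings (mergeFlags π)
mergeFlags-appendToBlock     []      _        _  = refl
mergeFlags-appendToBlock {x} (B ∷ π) (_ ∷ vs) lt =
  cong₂ _∷_ (cong (_∷ mergeFlags π) (mergesWithNext-∷ʳ B π (++⁻ʳ (map ∣_∣ B) lt))) (begin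
    map mergeFlags (map (B ∷_) (appendToBlock x π))
      ≡⟨ sym (map-∘ (appendToBlock x π)) ⟩
    map (λ τ → mergesWithNext B τ ∷ mergeFlags τ) (appendToBlock x π)
      ≡⟨ map-cong-local (All.tabulate λ τ∈ → cong (_∷ _) (mergesWithNext-Appended B vs (∈-appendToBlock⁻ π τ∈))) ⟩
    map (λ τ → mergesWithNext B π ∷ mergeFlags τ) (appendToBlock x π)
      ≡⟨ map-∘ (appendToBlock x π) ⟩
    map (mergesWithNext B π ∷_) (map mergeFlags (appendToBlock x π))
      ≡⟨ cong (map (mergesWithNext B π ∷_)) (mergeFlags-appendToBlock π vs (++⁻ʳ (map ∣_∣ B) lt)) ⟩
    map (mergesWithNext B π ∷_) (clearings (mergeFlags π))
      ∎)
  where open ≡-Reasoning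

trues-mergeFlags-addSingleton : ∀ {N} π → π ≢ [] → All (_< suc N) (absVals π) →
  trues (mergeFlags (addSingleton (suc N) π)) ≡ suc (trues (mergeFlags π))
trues-mergeFlags-addSingleton []          π≢[] _  = ⊥-elim (π≢[] refl)
trues-mergeFlags-addSingleton (B ∷ [])    _    lt
  rewrite Equivalence.to T-≡ (<⇒<ᵇ (maxAbs< B (++⁻ˡ (map ∣_∣ B) lt))) = refl
trues-mergeFlags-addSingleton (B ∷ C ∷ π) _    lt =
  trans (cong (_+_ d) (trues-mergeFlags-addSingleton (C ∷ π) (λ ()) (++⁻ʳ (map ∣_∣ B) lt))) (+-suc d _)
  where
  d : ℕ
  d = ⟦ mergesWithNext B (C ∷ π) ⟧

count-children : ∀ {n σ} → IsTypeB (suc n) σ → ∀ k v →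
  count (shapeᵇ k v ∘ mergeFlags) (children (2 + n) σ)
    ≡ 2 * (suc v * ⟦ shapeᵇ k (suc v) (mergeFlags σ) ⟧) + 2 * ((k ∸ v) * ⟦ shapeᵇ k v (mergeFlags σ) ⟧)
      + ⟦ shapeᵇ k v (mergeFlags (addSingleton (2 + n) σ)) ⟧
count-children {n} {σ} t k v = begin
    count p (appendToBlock (+ N) σ ++ appendToBlock (- (+ N)) σ ++ [ addSingleton N σ ])
      ≡⟨ count-++ p (appendToBlock (+ N) σ) _ ⟩
    count p (appendToBlock (+ N) σ) + count p (appendToBlock (- (+ N)) σ ++ [ addSingleton N σ ])
      ≡⟨ cong (_+_ (count p (appendToBlock (+ N) σ))) (count-++ p (appendToBlock (- (+ N)) σ) _) ⟩
    count p (appendToBlock (+ N) σ) + (count p (appendToBlock (- (+ N)) σ) + (s + 0))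
      ≡⟨ cong₂ (λ c⁺ c⁻ → c⁺ + (c⁻ + (s + 0)))
               (count-appendToBlock refl) (count-appendToBlock (∣-i∣≡∣i∣ (+ N))) ⟩
    c + (c + (s + 0))
      ≡⟨ rearrange (suc v * s₁) ((k ∸ v) * s₀) s ⟩
    2 * (suc v * s₁) + 2 * ((k ∸ v) * s₀) + s
      ∎
  where
  open ≡-Reasoning
  open IsTypeB t
  N s s₁ s₀ c : ℕ
  N = 2 + n
  s = ⟦ shapeᵇ k v (mergeFlags (addSingleton N σ)) ⟧
  s₁ = ⟦ shapeᵇ k (suc v) (mergeFlags σ) ⟧
  s₀ = ⟦ shapeᵇ k v (mergeFlags σ) ⟧
  c = suc v * s₁ + (k ∸ v) * s₀
  p : Partition → Bool
  p = shapeᵇ k v ∘ mergeFlags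
  count-appendToBlock : ∀ {x} → ∣ x ∣ ≡ N → count p (appendToBlock x σ) ≡ c
  count-appendToBlock {x} e = begin
      count p (appendToBlock x σ)
        ≡⟨ sym (count-map (shapeᵇ k v) mergeFlags (appendToBlock x σ)) ⟩
      count (shapeᵇ k v) (map mergeFlags (appendToBlock x σ))
        ≡⟨ cong (count (shapeᵇ k v)) (mergeFlags-appendToBlock σ blocks σ<x) ⟩
      count (shapeᵇ k v) (clearings (mergeFlags σ))
        ≡⟨ count-clearings (mergeFlags σ) k v ⟩
      c
        ∎
    where
    σ<x : All (_< ∣ x ∣) (absVals σ)
    σ<x = subst (λ M → All (_< M) (absVals σ)) (sym e) (All.map (s≤s ∘ proj₂) bounded)
  rearrange : ∀ x y z → (x + y) + ((x + y) + (z + 0)) ≡ 2 * x + 2 * y + z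
  rearrange = solve-∀

count-concatMap-children : ∀ {n} k v {πs} → All (IsTypeB (suc n)) πs →
  count (shapeᵇ k v ∘ mergeFlags) (concatMap (children (2 + n)) πs)
    ≡ 2 * (suc v * count (shapeᵇ k (suc v) ∘ mergeFlags) πs)
      + 2 * ((k ∸ v) * count (shapeᵇ k v ∘ mergeFlags) πs)
      + count (shapeᵇ k v ∘ mergeFlags ∘ addSingleton (2 + n)) πs
count-concatMap-children k v [] = rearrange (suc v) (k ∸ v)
  where
  rearrange : ∀ x y → 0 ≡ 2 * (x * 0) + 2 * (y * 0) + 0
  rearrange = solve-∀
count-concatMap-children {n} k v {σ ∷ πs} (t ∷ ts) = begin
    count p (children (2 + n) σ ++ concatMap (children (2 + n)) πs)
      ≡⟨ count-++ p (children (2 + n) σ) _ ⟩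
    count p (children (2 + n) σ) + count p (concatMap (children (2 + n)) πs)
      ≡⟨ cong₂ _+_ (count-children t k v) (count-concatMap-children k v ts) ⟩
    (2 * (suc v * ⟦ s₁ ⟧) + 2 * ((k ∸ v) * ⟦ s₀ ⟧) + ⟦ s ⟧)
      + (2 * (suc v * c₁) + 2 * ((k ∸ v) * c₀) + c)
      ≡⟨ rearrange (suc v) (k ∸ v) ⟦ s₁ ⟧ ⟦ s₀ ⟧ ⟦ s ⟧ c₁ c₀ c ⟩
    2 * (suc v * (⟦ s₁ ⟧ + c₁)) + 2 * ((k ∸ v) * (⟦ s₀ ⟧ + c₀)) + (⟦ s ⟧ + c)
      ∎
  where
  open ≡-Reasoning
  p : Partition → Bool
  p = shapeᵇ k v ∘ mergeFlags
  s₁ s₀ s : Bool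
  s₁ = shapeᵇ k (suc v) (mergeFlags σ)
  s₀ = shapeᵇ k v (mergeFlags σ)
  s = shapeᵇ k v (mergeFlags (addSingleton (2 + n) σ))
  c₁ c₀ c : ℕ
  c₁ = count (shapeᵇ k (suc v) ∘ mergeFlags) πs
  c₀ = count (shapeᵇ k v ∘ mergeFlags) πs
  c = count (shapeᵇ k v ∘ mergeFlags ∘ addSingleton (2 + n)) πs
  rearrange : ∀ d e x y z x′ y′ z′ →
    (2 * (d * x) + 2 * (e * y) + z) + (2 * (d * x′) + 2 * (e * y′) + z′)
      ≡ 2 * (d * (x + x′)) + 2 * (e * (y + y′)) + (z + z′)
  rearrange = solve-∀

-- The recurrence

b′-rec : ∀ n k v → b′ (2 + n) k v ≡
  2 * (suc v * b′ (1 + n) k (suc v)) + 2 * ((k ∸ v) * b′ (1 + n) k v)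
    + count (shapeᵇ k v ∘ mergeFlags ∘ addSingleton (2 + n)) (typeBPartitions (1 + n))
b′-rec n k v = count-concatMap-children k v (All.tabulate (typeBPartitions-sound (suc n)))

trues-mergeFlags-addSingleton-IsTypeB : ∀ {n σ} → IsTypeB (suc n) σ →
  trues (mergeFlags (addSingleton (2 + n) σ)) ≡ suc (trues (mergeFlags σ))
trues-mergeFlags-addSingleton-IsTypeB {σ = σ} t =
  trues-mergeFlags-addSingleton σ (IsTypeB-nonEmpty t) (All.map (s≤s ∘ proj₂) (IsTypeB.bounded t))

shapeᵇ-addSingleton : ∀ {n σ} k v → IsTypeB (suc n) σ →
  shapeᵇ (suc k) (suc v) (mergeFlags (addSingleton (2 + n) σ)) ≡ shapeᵇ k v (mergeFlags σ)
shapeᵇ-addSingleton {n} {σ} k v t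
  rewrite length-mergeFlags (addSingleton (2 + n) σ) | length-∷ʳ σ {[ + (2 + n) ]} | length-mergeFlags σ
        | trues-mergeFlags-addSingleton-IsTypeB t = refl

shapeᵇ-addSingleton-zero : ∀ {n σ} k → IsTypeB (suc n) σ →
  shapeᵇ k 0 (mergeFlags (addSingleton (2 + n) σ)) ≡ false
shapeᵇ-addSingleton-zero k t rewrite trues-mergeFlags-addSingleton-IsTypeB t = ∧-zeroʳ _

b′-rec-suc : ∀ n k v → b′ (2 + n) (suc k) (suc v) ≡
  2 * (suc (suc v) * b′ (1 + n) (suc k) (suc (suc v))) + 2 * ((k ∸ v) * b′ (1 + n) (suc k) (suc v))
    + b′ (1 + n) k v
b′-rec-suc n k v = trans (b′-rec n (suc k) (suc v))
  (cong (_+_ _) (count-cong-local (All.tabulate (shapeᵇ-addSingleton k v ∘ typeBPartitions-sound (suc n)))))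

b′-rec-zero : ∀ n k → b′ (2 + n) k 0 ≡ 2 * (1 * b′ (1 + n) k 1) + 2 * (k * b′ (1 + n) k 0)
b′-rec-zero n k = trans (b′-rec n k 0)
  (trans (cong (_+_ _) (count-none (All.tabulate (shapeᵇ-addSingleton-zero k ∘ typeBPartitions-sound (suc n)))))
         (+-identityʳ _))

b′-noBlocks : ∀ n v → b′ (suc n) 0 v ≡ 0
b′-noBlocks n v = count-none (All.tabulate (no-blocks ∘ IsTypeB-nonEmpty ∘ typeBPartitions-sound (suc n)))
  where
  no-blocks : ∀ {σ} → σ ≢ [] → shapeᵇ 0 v (mergeFlags σ) ≡ false
  no-blocks {[]}    σ≢[] = ⊥-elim (σ≢[] refl)
  no-blocks {_ ∷ _} _    = refl

b′-oneElement : ∀ k v → b′ 1 k (suc v) ≡ 0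
b′-oneElement k v rewrite ∧-zeroʳ (1 ≡ᵇ k) = refl

b′-unmerge-step : ∀ m → (∀ j w → suc w * b′ (suc m) (suc j) (suc w) ≡ m * b′ m j w) → ∀ k v →
  m * (2 * (suc v * b′ m k (suc v)) + 2 * ((k ∸ v) * b′ m k v)) + suc v * b′ (suc m) k v
    ≡ suc m * b′ (suc m) k v
b′-unmerge-step zero    _  k zero    = refl
b′-unmerge-step zero    _  k (suc v) rewrite b′-oneElement k v = *-zeroʳ (suc (suc v))
b′-unmerge-step (suc n) _  k zero    = begin
    suc n * R + 1 * b′ (2 + n) k 0 ≡⟨ cong (λ z → suc n * R + 1 * z) (b′-rec-zero n k) ⟩
    suc n * R + 1 * R              ≡⟨ rearrange (suc n) R ⟩
    suc (suc n) * R                ≡⟨ cong (suc (suc n) *_) (sym (b′-rec-zero n k)) ⟩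
    suc (suc n) * b′ (2 + n) k 0   ∎
  where
  open ≡-Reasoning
  R : ℕ
  R = 2 * (1 * b′ (1 + n) k 1) + 2 * (k * b′ (1 + n) k 0)
  rearrange : ∀ m r → m * r + 1 * r ≡ suc m * r
  rearrange = solve-∀
b′-unmerge-step (suc n) _  zero (suc v)
  rewrite b′-noBlocks n (suc (suc v)) | b′-noBlocks (suc n) (suc v) =
  rearrange (suc n) (suc (suc v))
  where
  rearrange : ∀ m c → m * (2 * (c * 0) + 2 * 0) + c * 0 ≡ suc m * 0
  rearrange = solve-∀
b′-unmerge-step (suc n) ih (suc k) (suc v) = begin
    m * R + suc (suc v) * C ≡⟨ rearrange₁ m R C (suc v) ⟩
    m * R + C + suc v * C   ≡⟨ cong (_+_ (m * R + C)) (ih k v) ⟩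
    m * R + C + m * S       ≡⟨ rearrange₂ m R C S ⟩
    m * (R + S) + C         ≡⟨ cong (λ z → m * z + C) (sym (b′-rec-suc n k v)) ⟩
    m * C + C               ≡⟨ +-comm (m * C) C ⟩
    suc m * C               ∎
  where
  open ≡-Reasoning
  m R C S : ℕ
  m = suc n
  R = 2 * (suc (suc v) * b′ (1 + n) (suc k) (suc (suc v))) + 2 * ((k ∸ v) * b′ (1 + n) (suc k) (suc v))
  C = b′ (2 + n) (suc k) (suc v)
  S = b′ (1 + n) k v
  rearrange₁ : ∀ m r c s → m * r + suc s * c ≡ m * r + c + s * c
  rearrange₁ = solve-∀
  rearrange₂ : ∀ m r c t → m * r + c + m * t ≡ m * (r + t) + c
  rearrange₂ = solve-∀

b′-unmerge : ∀ m k v → suc v * b′ (suc m) (suc k) (suc v) ≡ m * b′ m k v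
b′-unmerge zero    k v = trans (cong (suc v *_) (b′-oneElement (suc k) v)) (*-zeroʳ (suc v))
b′-unmerge (suc n) k v = begin
    suc v * b′ (2 + n) (suc k) (suc v)
      ≡⟨ cong (suc v *_) (b′-rec-suc n k v) ⟩
    suc v * (2 * (suc (suc v) * X₂) + 2 * ((k ∸ v) * X₁) + C)
      ≡⟨ rearrange₁ (suc v) (k ∸ v) X₂ X₁ C ⟩
    2 * (suc v * (suc (suc v) * X₂)) + 2 * ((k ∸ v) * (suc v * X₁)) + suc v * C
      ≡⟨ cong₂ (λ y z → 2 * (suc v * y) + 2 * ((k ∸ v) * z) + suc v * C)
               (b′-unmerge n k (suc v)) (b′-unmerge n k v) ⟩
    2 * (suc v * (n * b′ n k (suc v))) + 2 * ((k ∸ v) * (n * b′ n k v)) + suc v * C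
      ≡⟨ rearrange₂ n (suc v) (k ∸ v) (b′ n k (suc v)) (b′ n k v) (suc v * C) ⟩
    n * (2 * (suc v * b′ n k (suc v)) + 2 * ((k ∸ v) * b′ n k v)) + suc v * C
      ≡⟨ b′-unmerge-step n (b′-unmerge n) k v ⟩
    suc n * C
      ∎
  where
  open ≡-Reasoning
  X₂ X₁ C : ℕ
  X₂ = b′ (1 + n) (suc k) (suc (suc v))
  X₁ = b′ (1 + n) (suc k) (suc v)
  C = b′ (1 + n) k v
  rearrange₁ : ∀ s d x₂ x₁ c →
    s * (2 * (suc s * x₂) + 2 * (d * x₁) + c) ≡ 2 * (s * (suc s * x₂)) + 2 * (d * (s * x₁)) + s * c
  rearrange₁ = solve-∀
  rearrange₂ : ∀ m s d y z w →
    2 * (s * (m * y)) + 2 * (d * (m * z)) + w ≡ m * (2 * (s * y) + 2 * (d * z)) + w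
  rearrange₂ = solve-∀

mainTheorem9 : (b 0 0 ≡ 1) × (b 1 0 ≡ 0) × (b 1 1 ≡ 1)
    × (∀ m → b (2 + m) 0 ≡ 2 * 0 * b (1 + m) 0 + 0)
    × (∀ m k → b (2 + m) (suc k) ≡ 2 * suc k * b (1 + m) (suc k) + 2 * m * b m k)
mainTheorem9 = refl , refl , refl , no-blocks , recurrence
  where
  open ≡-Reasoning
  no-blocks : ∀ m → b (2 + m) 0 ≡ 2 * 0 * b (1 + m) 0 + 0
  no-blocks m = trans (b≡b′ (2 + m) 0) (b′-noBlocks (1 + m) 0)
  rearrange : ∀ m k x y → 2 * (m * y) + 2 * (k * x) ≡ 2 * k * x + 2 * m * y
  rearrange = solve-∀
  recurrence : ∀ m k → b (2 + m) (suc k) ≡ 2 * suc k * b (1 + m) (suc k) + 2 * m * b m k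
  recurrence m k = begin
    b (2 + m) (suc k)
      ≡⟨ b≡b′ (2 + m) (suc k) ⟩
    b′ (2 + m) (suc k) 0
      ≡⟨ b′-rec-zero m (suc k) ⟩
    2 * (1 * b′ (1 + m) (suc k) 1) + 2 * (suc k * b′ (1 + m) (suc k) 0)
      ≡⟨ cong (λ z → 2 * z + 2 * (suc k * b′ (1 + m) (suc k) 0)) (b′-unmerge m k 0) ⟩
    2 * (m * b′ m k 0) + 2 * (suc k * b′ (1 + m) (suc k) 0)
      ≡⟨ rearrange m (suc k) _ _ ⟩
    2 * suc k * b′ (1 + m) (suc k) 0 + 2 * m * b′ m k 0
      ≡⟨ sym (cong₂ (λ x y → 2 * suc k * x + 2 * m * y) (b≡b′ (1 + m) (suc k)) (b≡b′ m k)) ⟩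
    2 * suc k * b (1 + m) (suc k) + 2 * m * b m k
      ∎
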